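{- Let $G$ be a connected signed graph, let $k$ be an integer, let $v\in V(G)$ and let $u_1,\ldots,u_c$ be pairwise non-adjacent neighbors of $v$ with $c\ge 2$ such that $G'=G-\{v,u_1,\ldots,u_c\}$ is connected. Let $k'=k-c+1$. If $G'$ has a balanced subgraph with at least $\frac{m'}{2}+\frac{n'-1}{4}+\frac{k'}{4}$ edges, where $n'=|V(G')|$ and $m'=|E(G')|$, then $G$ has a balanced subgraph with at least $\frac{m}{2}+\frac{n-1}{4}+\frac{k}{4}$ edges, where $n=|V(G)|$ and $m=|E(G)|$. (That is, the reduction rule replacing $(G,k)$ by $(G',k')$ is safe: it never turns a No-instance into a Yes-instance.)
   Context: A signed graph is a simple undirected graph in which each edge is labelled positive or negative. A signed graph is balanced if there is a partition $(V_1,V_2)$ of its vertex set such that every edge with both endpoints in the same part is positive and every edge with endpoints in different parts is negative. A balanced subgraph of $G$ means a subgraph of $G$ that is balanced. -}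

module Defs where

open import Data.Nat using (ℕ; zero; suc; _+_; _*_)
open import Data.Integer using (ℤ; +_; _-_; _≤_) renaming (_+_ to _+ℤ_; _*_ to _*ℤ_)
open import Data.Bool using (Bool; true; false; _∧_; _∨_; not; if_then_else_)
open import Data.Maybe using (Maybe; just; nothing)
open import Data.Fin using (Fin; toℕ; _≟_)
open import Data.Fin.Properties using ()
open import Data.List using (List; map; allFin)
open import Data.Nat.ListAction using (sum)
open import Data.Bool.ListAction using (any)
open import Data.Empty using (⊥-elim)
open import Data.Product using (Σ; _×_; _,_; ∃)
open import Data.Nat using (_<ᵇ_)
open import Relation.Nullary using (¬_)
open import Relation.Nullary.Decidable using (⌊_⌋)
open import Relation.Binary.PropositionalEquality using (_≡_; _≢_; refl; sym)

data Sign : Set where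
  pos neg : Sign

-- A (finite, simple, undirected) signed graph whose vertex set is a subset
-- V of Fin N.  adj i j = nothing : no edge; just s : edge of sign s.
record SignedGraph (N : ℕ) : Set where
  field
    V      : Fin N → Bool
    adj    : Fin N → Fin N → Maybe Sign
    adj-sym    : ∀ i j → adj i j ≡ adj j i
    adj-irrefl : ∀ i → adj i i ≡ nothing
    adj-in     : ∀ i j → adj i j ≢ nothing → (V i ≡ true) × (V j ≡ true)
open SignedGraph public

count : ∀ {N} → (Fin N → Bool) → ℕ
count {N} p = sum (map (λ i → if p i then 1 else 0) (allFin N))

countPairs : ∀ {N} → (Fin N → Fin N → Bool) → ℕ
countPairs {N} r = sum (map (λ i → count (λ j → (toℕ i <ᵇ toℕ j) ∧ r i j)) (allFin N))

isEdgeᵇ : Maybe Sign → Bool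
isEdgeᵇ nothing  = false
isEdgeᵇ (just _) = true

∣V∣ : ∀ {N} → SignedGraph N → ℕ
∣V∣ G = count (V G)

∣E∣ : ∀ {N} → SignedGraph N → ℕ
∣E∣ G = countPairs (λ i j → isEdgeᵇ (adj G i j))

Adjacent : ∀ {N} → SignedGraph N → Fin N → Fin N → Set
Adjacent G i j = adj G i j ≢ nothing

data Walk {N} (G : SignedGraph N) : Fin N → Fin N → Set where
  here : ∀ {i} → V G i ≡ true → Walk G i i
  step : ∀ {i j k} → Adjacent G i j → Walk G j k → Walk G i k

Connected : ∀ {N} → SignedGraph N → Set
Connected G = ∀ i j → V G i ≡ true → V G j ≡ true → Walk G i j

private
  killᵇ : ∀ {N} → (Fin N → Bool) → (Fin N → Fin N → Maybe Sign) → Fin N → Fin N → Maybe Sign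
  killᵇ R a i j = if R i ∨ R j then nothing else a i j

  ∨-comm : ∀ x y → (x ∨ y) ≡ (y ∨ x)
  ∨-comm false false = refl
  ∨-comm false true  = refl
  ∨-comm true  false = refl
  ∨-comm true  true  = refl

delete : ∀ {N} → SignedGraph N → (Fin N → Bool) → SignedGraph N
delete {N} G R = record
  { V = λ i → V G i ∧ not (R i)
  ; adj = killᵇ R (adj G)
  ; adj-sym = symP
  ; adj-irrefl = irr
  ; adj-in = inn
  }
  where
  symP : ∀ i j → killᵇ R (adj G) i j ≡ killᵇ R (adj G) j i
  symP i j with R i | R j | adj-sym G i j
  ... | true  | true  | _ = refl
  ... | true  | false | _ = refl
  ... | false | true  | _ = refl
  ... | false | false | e = e
  irr : ∀ i → killᵇ R (adj G) i i ≡ nothing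
  irr i with R i | adj-irrefl G i
  ... | true  | _ = refl
  ... | false | e = e
  inn : ∀ i j → killᵇ R (adj G) i j ≢ nothing →
        ((V G i ∧ not (R i)) ≡ true) × ((V G j ∧ not (R j)) ≡ true)
  inn i j ne with R i | R j | adj-in G i j
  ... | true  | _     | _ = ⊥-elim (ne refl)
  ... | false | true  | _ = ⊥-elim (ne refl)
  inn i j ne | false | false | f with f ne
  ... | p , q = helper p , helper q
    where
    helper : ∀ {b} → b ≡ true → (b ∧ true) ≡ true
    helper {true} refl = refl

removedSet : ∀ {N c} → Fin N → (Fin c → Fin N) → Fin N → Bool
removedSet {N} {c} v us i = ⌊ i ≟ v ⌋ ∨ any (λ t → ⌊ i ≟ us t ⌋) (allFin c)

record Subgraph {N} (G : SignedGraph N) : Set where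
  field
    W      : Fin N → Bool
    F      : Fin N → Fin N → Bool
    W⊆V    : ∀ i → W i ≡ true → V G i ≡ true
    F-sym  : ∀ i j → F i j ≡ F j i
    F⊆E    : ∀ i j → F i j ≡ true → Adjacent G i j
    F-ends : ∀ i j → F i j ≡ true → (W i ≡ true) × (W j ≡ true)
open Subgraph public

∣E[_]∣ : ∀ {N} {G : SignedGraph N} → Subgraph G → ℕ
∣E[ H ]∣ = countPairs (F H)

-- H is balanced: there is a partition (V₁,V₂) of W, encoded by σ (V₁ = σ⁻¹ true
-- restricted to W), such that positive edges lie inside a part and negative
-- edges go across.
Balanced : ∀ {N} {G : SignedGraph N} → Subgraph G → Set
Balanced {N} {G} H = Σ (Fin N → Bool) λ σ → ∀ i j → F H i j ≡ true →
  (adj G i j ≡ just pos → σ i ≡ σ j) × (adj G i j ≡ just neg → σ i ≢ σ j)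

-- G has a balanced subgraph with at least m/2 + (n-1)/4 + k/4 edges
-- (multiplied by 4 to stay in ℤ).
HasBigBalanced : ∀ {N} → SignedGraph N → ℤ → Set
HasBigBalanced G k = Σ (Subgraph G) λ H → Balanced H ×
  ((+ (2 * ∣E∣ G) +ℤ (+ ∣V∣ G - + 1) +ℤ k) ≤ + (4 * ∣E[ H ]∣))

-- Let R = {v, u₁, …, u_c} and let σ′ balance a subgraph H′ of G − R. Since the uᵢ are
-- independent, the edges inside R are exactly the c spokes v uᵢ, so some signing τ of R
-- satisfies all of them. Extend σ′ by τ on R and add to H′ every edge touching R that the
-- glued signing satisfies; the result is balanced. Negating τ keeps the edges inside R
-- satisfied and flips the status of every edge between R and G − R, so for one of τ, ¬ τ
-- at least (t + i)/2 edges are gained, where t = m − m′ counts the edges touching R and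
-- i ≥ c those inside R. Together with n ≤ n′ + c + 1 this is exactly the required bound.
module Submission where

open import Defs
open import Data.Bool using (Bool; true; false; _∧_; _∨_; not; _xor_; if_then_else_)
open import Data.Bool.Properties
  using (T-≡; ¬-not; ∨-comm; ∨-zeroʳ; ∧-zeroʳ; xor-comm; not-involutive; not-distribˡ-xor)
open import Data.Bool.ListAction using (any)
open import Data.Empty using (⊥-elim)
open import Data.Fin using (Fin; toℕ; _≟_) renaming (zero to fzero; suc to fsuc)
open import Data.Fin.Properties using (toℕ-injective; suc-injective)
open import Data.Integer using (ℤ; +_; -_; _-_; +≤+) renaming (_+_ to _+ℤ_; _≤_ to _≤ℤ_)
open import Data.Integer.Properties using (pos-+)
  renaming (+-monoˡ-≤ to +ℤ-monoˡ-≤; module ≤-Reasoning to ℤ-≤-Reasoning)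
open import Data.Integer.Tactic.RingSolver using (solve-∀)
open import Data.List using ([]; _∷_; map; tabulate; allFin)
open import Data.List.Relation.Unary.Any.Properties using (any⁻; tabulate⁻)
open import Data.Maybe using (Maybe; just; nothing)
open import Data.Nat using (ℕ; zero; suc; _+_; _*_; _≤_; z≤n; s≤s; _<ᵇ_)
import Data.Nat.ListAction as List
open import Data.Nat.Properties
  using (+-*-semiring; +-identityʳ; *-identityˡ; *-distribˡ-+; *-distribʳ-+; *-zeroʳ; +-comm;
         +-mono-≤; +-monoʳ-≤; +-monoˡ-≤; *-monoʳ-≤; ≤-refl; ≤-reflexive; ≤-trans; ≤-total;
         module ≤-Reasoning)
  renaming (_≟_ to _ℕ≟_)
open import Data.Nat.Tactic.RingSolver using (solve)
open import Algebra.Properties.Semiring.Sum +-*-semiring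
  using (sum; sum-cong-≗; sum-replicate-zero; ∑-distrib-+; ∑-comm; *-distribˡ-sum; *-distribʳ-sum)
open import Data.Product using (Σ; _×_; _,_; ∃)
open import Data.Sum using (_⊎_; inj₁; inj₂; [_,_]′)
open import Function.Bundles using (Equivalence)
open import Function.Definitions using (Injective)
open import Relation.Binary.PropositionalEquality
open import Relation.Nullary using (¬_; Dec; yes; no)
open import Relation.Nullary.Decidable using (⌊_⌋; toWitness; fromWitness)

-- Defined by matching rather than as Defs' if b then 1 else 0, so that it does not unfold
-- during unification.
⟦_⟧ : Bool → ℕ
⟦ false ⟧ = 0
⟦ true  ⟧ = 1

if-1-0≡⟦⟧ : ∀ b → (if b then 1 else 0) ≡ ⟦ b ⟧
if-1-0≡⟦⟧ false = refl
if-1-0≡⟦⟧ true  = refl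

⟦∧⟧ : ∀ a b → ⟦ a ∧ b ⟧ ≡ ⟦ a ⟧ * ⟦ b ⟧
⟦∧⟧ true  b = sym (+-identityʳ ⟦ b ⟧)
⟦∧⟧ false b = refl

⟦∨⟧-≤ : ∀ a b → ⟦ a ∨ b ⟧ ≤ ⟦ a ⟧ + ⟦ b ⟧
⟦∨⟧-≤ true  b = s≤s z≤n
⟦∨⟧-≤ false b = ≤-refl

⟦⟧-∨-disjoint : ∀ x y → (x ≡ true → y ≡ false) → ⟦ x ∨ y ⟧ ≡ ⟦ x ⟧ + ⟦ y ⟧
⟦⟧-∨-disjoint true  y x⇒¬y rewrite x⇒¬y refl = refl
⟦⟧-∨-disjoint false y _    = refl

⟦⟧-mono : ∀ {x y} → (x ≡ true → y ≡ true) → ⟦ x ⟧ ≤ ⟦ y ⟧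
⟦⟧-mono {false}         _   = z≤n
⟦⟧-mono {true}  {true}  _   = ≤-refl
⟦⟧-mono {true}  {false} x⇒y with x⇒y refl
... | ()

⟦b⟧+⟦not-b⟧ : ∀ b → ⟦ b ⟧ + ⟦ not b ⟧ ≡ 1
⟦b⟧+⟦not-b⟧ true  = refl
⟦b⟧+⟦not-b⟧ false = refl

∨≡true⁻ : ∀ x {y} → x ∨ y ≡ true → x ≡ true ⊎ y ≡ true
∨≡true⁻ true  _ = inj₁ refl
∨≡true⁻ false h = inj₂ h

∧≡true⁻ʳ : ∀ x {y} → x ∧ y ≡ true → y ≡ true
∧≡true⁻ʳ true h = h

∧-swap : ∀ x y z → x ∧ y ∧ z ≡ y ∧ x ∧ z
∧-swap true  true  z = refl
∧-swap true  false z = refl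
∧-swap false true  z = refl
∧-swap false false z = refl

∧-not⇒false : ∀ x r → x ∧ not r ≡ true → r ≡ false
∧-not⇒false true false _ = refl

not-xor-not : ∀ x y → not x xor not y ≡ x xor y
not-xor-not true  y = refl
not-xor-not false y = not-involutive y

-- Not definitional: ⌊_⌋ = isYes matches on a Dec constructor, but Fin's _≟_ on successors
-- returns a map′ of the recursive call.
⌊suc≟suc⌋ : ∀ {n} (i x : Fin n) → ⌊ fsuc i ≟ fsuc x ⌋ ≡ ⌊ i ≟ x ⌋
⌊suc≟suc⌋ i x with i ≟ x
... | yes _ = refl
... | no  _ = refl

≟-sound : ∀ {n} {i x : Fin n} → ⌊ i ≟ x ⌋ ≡ true → i ≡ x
≟-sound i≟x = toWitness (Equivalence.from T-≡ i≟x)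

+-≤-double : ∀ {a b} → b ≤ a → a + b ≤ 2 * a
+-≤-double {a} b≤a = +-monoʳ-≤ a (≤-trans b≤a (≤-reflexive (sym (+-identityʳ a))))

∑-mono-≤ : ∀ {n} {f g : Fin n → ℕ} → (∀ i → f i ≤ g i) → sum f ≤ sum g
∑-mono-≤ {zero}  f≤g = z≤n
∑-mono-≤ {suc n} f≤g = +-mono-≤ (f≤g fzero) (∑-mono-≤ (λ i → f≤g (fsuc i)))

∑-const-1 : ∀ n → sum {n} (λ _ → 1) ≡ n
∑-const-1 zero    = refl
∑-const-1 (suc n) = cong suc (∑-const-1 n)

∑-δ : ∀ {n} (x : Fin n) → sum (λ i → ⟦ ⌊ i ≟ x ⌋ ⟧) ≡ 1
∑-δ {suc n} fzero    = cong suc (sum-replicate-zero n)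
∑-δ {suc n} (fsuc x) = trans (sum-cong-≗ (λ i → cong ⟦_⟧ (⌊suc≟suc⌋ i x))) (∑-δ x)

∑∑-δ : ∀ {m n} (x : Fin m) (f : Fin n → ℕ) → sum (λ i → sum (λ j → ⟦ ⌊ i ≟ x ⌋ ⟧ * f j)) ≡ sum f
∑∑-δ x f = begin
  sum (λ i → sum (λ j → ⟦ ⌊ i ≟ x ⌋ ⟧ * f j)) ≡⟨ sum-cong-≗ (λ i → *-distribˡ-sum ⟦ ⌊ i ≟ x ⌋ ⟧ f) ⟨
  sum (λ i → ⟦ ⌊ i ≟ x ⌋ ⟧ * sum f)           ≡⟨ *-distribʳ-sum (sum f) (λ i → ⟦ ⌊ i ≟ x ⌋ ⟧) ⟨
  sum (λ i → ⟦ ⌊ i ≟ x ⌋ ⟧) * sum f           ≡⟨ cong (_* sum f) (∑-δ x) ⟩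
  1 * sum f                                   ≡⟨ *-identityˡ (sum f) ⟩
  sum f                                       ∎
  where open ≡-Reasoning

∑∑-distrib-+ : ∀ {m n} (f g : Fin m → Fin n → ℕ) →
  sum (λ i → sum (λ j → f i j + g i j)) ≡ sum (λ i → sum (λ j → f i j)) + sum (λ i → sum (λ j → g i j))
∑∑-distrib-+ f g = trans (sum-cong-≗ (λ i → ∑-distrib-+ (f i) (g i)))
  (∑-distrib-+ (λ i → sum (f i)) (λ i → sum (g i)))

∑⟦⟧≤⟦any⟧ : ∀ {a} {A : Set a} {n} (p : A → Bool) (g : Fin n → A) →
  (∀ s t → p (g s) ≡ true → p (g t) ≡ true → s ≡ t) →
  sum (λ t → ⟦ p (g t) ⟧) ≤ ⟦ any p (tabulate g) ⟧
∑⟦⟧≤⟦any⟧ {n = zero}  p g unique = z≤n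
∑⟦⟧≤⟦any⟧ {n = suc n} p g unique with p (g fzero) in p₀
... | true  = ≤-reflexive (cong suc (trans (sum-cong-≗ rest-false) (sum-replicate-zero n)))
  where
  rest-false : ∀ t → ⟦ p (g (fsuc t)) ⟧ ≡ 0
  rest-false t with p (g (fsuc t)) in pₜ
  ... | true  with unique fzero (fsuc t) p₀ pₜ
  ...   | ()
  rest-false t | false = refl
... | false = ∑⟦⟧≤⟦any⟧ p (λ t → g (fsuc t)) (λ s t ps pt → suc-injective (unique (fsuc s) (fsuc t) ps pt))

sum-map-tabulate : ∀ {a} {A : Set a} {n} (f : A → ℕ) (g : Fin n → A) →
  List.sum (map f (tabulate g)) ≡ sum (λ i → f (g i))
sum-map-tabulate {n = zero}  f g = refl
sum-map-tabulate {n = suc n} f g = cong (λ s → f (g fzero) + s) (sum-map-tabulate f (λ i → g (fsuc i)))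

count≡∑ : ∀ {N} (p : Fin N → Bool) → count p ≡ sum (λ i → ⟦ p i ⟧)
count≡∑ p = trans (sum-map-tabulate (λ i → if p i then 1 else 0) (λ i → i))
  (sum-cong-≗ (λ i → if-1-0≡⟦⟧ (p i)))

pairSum : ∀ {N} → (Fin N → Fin N → ℕ) → ℕ
pairSum w = sum (λ i → sum (λ j → ⟦ toℕ i <ᵇ toℕ j ⟧ * w i j))

pairSum-cong : ∀ {N} {w w′ : Fin N → Fin N → ℕ} → (∀ i j → w i j ≡ w′ i j) → pairSum w ≡ pairSum w′
pairSum-cong w≡w′ = sum-cong-≗ (λ i → sum-cong-≗ (λ j → cong (⟦ toℕ i <ᵇ toℕ j ⟧ *_) (w≡w′ i j)))

pairSum-+ : ∀ {N} (w w′ : Fin N → Fin N → ℕ) →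
  pairSum (λ i j → w i j + w′ i j) ≡ pairSum w + pairSum w′
pairSum-+ w w′ = trans (sum-cong-≗ (λ i → sum-cong-≗ (λ j → *-distribˡ-+ ⟦ toℕ i <ᵇ toℕ j ⟧ (w i j) (w′ i j))))
  (∑∑-distrib-+ (λ i j → ⟦ toℕ i <ᵇ toℕ j ⟧ * w i j) (λ i j → ⟦ toℕ i <ᵇ toℕ j ⟧ * w′ i j))

countPairs≡pairSum : ∀ {N} (r : Fin N → Fin N → Bool) → countPairs r ≡ pairSum (λ i j → ⟦ r i j ⟧)
countPairs≡pairSum r = trans (sum-map-tabulate (λ i → count (λ j → (toℕ i <ᵇ toℕ j) ∧ r i j)) (λ i → i))
  (sum-cong-≗ (λ i → trans (count≡∑ (λ j → (toℕ i <ᵇ toℕ j) ∧ r i j))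
                           (sum-cong-≗ (λ j → ⟦∧⟧ (toℕ i <ᵇ toℕ j) (r i j)))))

countPairs-+ : ∀ {N} (r s : Fin N → Fin N → Bool) →
  countPairs r + countPairs s ≡ pairSum (λ i j → ⟦ r i j ⟧ + ⟦ s i j ⟧)
countPairs-+ r s = trans (cong₂ _+_ (countPairs≡pairSum r) (countPairs≡pairSum s))
  (sym (pairSum-+ (λ i j → ⟦ r i j ⟧) (λ i j → ⟦ s i j ⟧)))

countPairs-split : ∀ {N} {r s t : Fin N → Fin N → Bool} →
  (∀ i j → ⟦ r i j ⟧ ≡ ⟦ s i j ⟧ + ⟦ t i j ⟧) → countPairs r ≡ countPairs s + countPairs t
countPairs-split {r = r} {s} {t} r≡s+t =
  trans (countPairs≡pairSum r) (trans (pairSum-cong r≡s+t) (sym (countPairs-+ s t)))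

<ᵇ-total : ∀ {m n} → m ≢ n → ⟦ m <ᵇ n ⟧ + ⟦ n <ᵇ m ⟧ ≡ 1
<ᵇ-total {zero}  {zero}  0≢0 = ⊥-elim (0≢0 refl)
<ᵇ-total {zero}  {suc n} _   = refl
<ᵇ-total {suc m} {zero}  _   = refl
<ᵇ-total {suc m} {suc n} m≢n = <ᵇ-total (λ m≡n → m≢n (cong suc m≡n))

handshake : ∀ {N} (w : Fin N → Fin N → ℕ) → (∀ i j → w i j ≡ w j i) → (∀ i → w i i ≡ 0) →
  sum (λ i → sum (λ j → w i j)) ≡ pairSum w + pairSum w
handshake w w-sym w-diag = begin
  sum (λ i → sum (λ j → w i j))
    ≡⟨ sum-cong-≗ (λ i → sum-cong-≗ (λ j → by-order i j)) ⟩
  sum (λ i → sum (λ j → ⟦ toℕ i <ᵇ toℕ j ⟧ * w i j + ⟦ toℕ j <ᵇ toℕ i ⟧ * w i j))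
    ≡⟨ ∑∑-distrib-+ (λ i j → ⟦ toℕ i <ᵇ toℕ j ⟧ * w i j) (λ i j → ⟦ toℕ j <ᵇ toℕ i ⟧ * w i j) ⟩
  pairSum w + sum (λ i → sum (λ j → ⟦ toℕ j <ᵇ toℕ i ⟧ * w i j))
    ≡⟨ cong (λ s → pairSum w + s) (∑-comm (λ i j → ⟦ toℕ j <ᵇ toℕ i ⟧ * w i j)) ⟩
  pairSum w + sum (λ j → sum (λ i → ⟦ toℕ j <ᵇ toℕ i ⟧ * w i j))
    ≡⟨ cong (λ s → pairSum w + s) (pairSum-cong (λ j i → w-sym i j)) ⟩
  pairSum w + pairSum w ∎
  where
  open ≡-Reasoning
  by-order : ∀ i j → w i j ≡ ⟦ toℕ i <ᵇ toℕ j ⟧ * w i j + ⟦ toℕ j <ᵇ toℕ i ⟧ * w i j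
  by-order i j with toℕ i ℕ≟ toℕ j
  ... | yes i≡j rewrite toℕ-injective i≡j | w-diag j = sym (cong₂ _+_ (*-zeroʳ ⟦ toℕ j <ᵇ toℕ j ⟧) (*-zeroʳ ⟦ toℕ j <ᵇ toℕ j ⟧))
  ... | no  i≢j = sym (begin
    ⟦ toℕ i <ᵇ toℕ j ⟧ * w i j + ⟦ toℕ j <ᵇ toℕ i ⟧ * w i j ≡⟨ *-distribʳ-+ (w i j) ⟦ toℕ i <ᵇ toℕ j ⟧ ⟦ toℕ j <ᵇ toℕ i ⟧ ⟨
    (⟦ toℕ i <ᵇ toℕ j ⟧ + ⟦ toℕ j <ᵇ toℕ i ⟧) * w i j       ≡⟨ cong (_* w i j) (<ᵇ-total i≢j) ⟩
    1 * w i j                                                ≡⟨ *-identityˡ (w i j) ⟩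
    w i j                                                    ∎)

satisfiedᵇ : Maybe Sign → Bool → Bool → Bool
satisfiedᵇ nothing    x y = false
satisfiedᵇ (just pos) x y = not (x xor y)
satisfiedᵇ (just neg) x y = x xor y

negativeᵇ : Maybe Sign → Bool
negativeᵇ (just neg) = true
negativeᵇ _          = false

satisfied⇒edge : ∀ a {x y} → satisfiedᵇ a x y ≡ true → a ≢ nothing
satisfied⇒edge (just _) _ ()

satisfied-sound : ∀ a x y → satisfiedᵇ a x y ≡ true →
  (a ≡ just pos → x ≡ y) × (a ≡ just neg → x ≢ y)
satisfied-sound (just pos) true  true  _ = (λ _ → refl) , (λ ())
satisfied-sound (just pos) false false _ = (λ _ → refl) , (λ ())
satisfied-sound (just neg) true  false _ = (λ ()) , (λ _ ())
satisfied-sound (just neg) false true  _ = (λ ()) , (λ _ ())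

satisfied-sym : ∀ a x y → satisfiedᵇ a x y ≡ satisfiedᵇ a y x
satisfied-sym nothing    x y = refl
satisfied-sym (just pos) x y = cong not (xor-comm x y)
satisfied-sym (just neg) x y = xor-comm x y

satisfied-not : ∀ a x y → satisfiedᵇ a (not x) (not y) ≡ satisfiedᵇ a x y
satisfied-not nothing    x y = refl
satisfied-not (just pos) x y = cong not (not-xor-not x y)
satisfied-not (just neg) x y = not-xor-not x y

satisfied-flipˡ : ∀ a x y → ⟦ satisfiedᵇ a x y ⟧ + ⟦ satisfiedᵇ a (not x) y ⟧ ≡ ⟦ isEdgeᵇ a ⟧
satisfied-flipˡ nothing    x y = refl
satisfied-flipˡ (just pos) x y rewrite sym (not-distribˡ-xor x y) = ⟦b⟧+⟦not-b⟧ (not (x xor y))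
satisfied-flipˡ (just neg) x y rewrite sym (not-distribˡ-xor x y) = ⟦b⟧+⟦not-b⟧ (x xor y)

satisfied-flipʳ : ∀ a x y → ⟦ satisfiedᵇ a x y ⟧ + ⟦ satisfiedᵇ a x (not y) ⟧ ≡ ⟦ isEdgeᵇ a ⟧
satisfied-flipʳ a x y rewrite satisfied-sym a x y | satisfied-sym a x (not y) = satisfied-flipˡ a y x

satisfied-negativeᵇ : ∀ {a₀} a → a₀ ≡ nothing → a ≢ nothing →
  satisfiedᵇ a (negativeᵇ a₀) (negativeᵇ a) ≡ true
satisfied-negativeᵇ nothing    refl a≢∅ = ⊥-elim (a≢∅ refl)
satisfied-negativeᵇ (just pos) refl _   = refl
satisfied-negativeᵇ (just neg) refl _   = refl

isEdgeᵇ-adjacent : ∀ {a : Maybe Sign} → a ≢ nothing → isEdgeᵇ a ≡ true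
isEdgeᵇ-adjacent {nothing} a≢∅ = ⊥-elim (a≢∅ refl)
isEdgeᵇ-adjacent {just _}  _   = refl

_Balances_ : ∀ {N} {G : SignedGraph N} → (Fin N → Bool) → Subgraph G → Set
_Balances_ {G = G} σ H = ∀ i j → F H i j ≡ true →
  (adj G i j ≡ just pos → σ i ≡ σ j) × (adj G i j ≡ just neg → σ i ≢ σ j)

module Deletion {N} (G : SignedGraph N) (R : Fin N → Bool) where

  G-R : SignedGraph N
  G-R = delete G R

  touching : Fin N → Fin N → Bool
  touching i j = (R i ∨ R j) ∧ isEdgeᵇ (adj G i j)

  inside : Fin N → Fin N → Bool
  inside i j = R i ∧ R j ∧ isEdgeᵇ (adj G i j)

  kept⇒¬removed : ∀ {i} → V G-R i ≡ true → R i ≡ false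
  kept⇒¬removed {i} = ∧-not⇒false (V G i) (R i)

  adj-kept : ∀ {i j} → R i ≡ false → R j ≡ false → adj G-R i j ≡ adj G i j
  adj-kept {i} {j} Ri Rj rewrite Ri | Rj = refl

  adjacent-kept : ∀ {i j} → Adjacent G-R i j → Adjacent G i j
  adjacent-kept {i} {j} ij with R i ∨ R j
  ... | true  = ⊥-elim (ij refl)
  ... | false = ij

  ∣V∣-delete : ∣V∣ G ≤ ∣V∣ G-R + sum (λ i → ⟦ R i ⟧)
  ∣V∣-delete = begin
    ∣V∣ G                                                  ≡⟨ count≡∑ (V G) ⟩
    sum (λ i → ⟦ V G i ⟧)                                  ≤⟨ ∑-mono-≤ (λ i → split (V G i) (R i)) ⟩
    sum (λ i → ⟦ V G i ∧ not (R i) ⟧ + ⟦ R i ⟧)            ≡⟨ ∑-distrib-+ (λ i → ⟦ V G-R i ⟧) (λ i → ⟦ R i ⟧) ⟩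
    sum (λ i → ⟦ V G-R i ⟧) + sum (λ i → ⟦ R i ⟧)          ≡⟨ cong (_+ sum (λ i → ⟦ R i ⟧)) (count≡∑ (V G-R)) ⟨
    ∣V∣ G-R + sum (λ i → ⟦ R i ⟧)                          ∎
    where
    open ≤-Reasoning
    split : ∀ x r → ⟦ x ⟧ ≤ ⟦ x ∧ not r ⟧ + ⟦ r ⟧
    split true  true  = s≤s z≤n
    split true  false = s≤s z≤n
    split false r     = z≤n

  ∣E∣-delete : ∣E∣ G ≡ ∣E∣ G-R + countPairs touching
  ∣E∣-delete = countPairs-split (λ i j → split (R i ∨ R j) (adj G i j))
    where
    split : ∀ r a → ⟦ isEdgeᵇ a ⟧ ≡ ⟦ isEdgeᵇ (if r then nothing else a) ⟧ + ⟦ r ∧ isEdgeᵇ a ⟧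
    split true  a = refl
    split false a = sym (+-identityʳ _)

  inside-sym : ∀ i j → inside i j ≡ inside j i
  inside-sym i j = trans (∧-swap (R i) (R j) _) (cong (λ a → R j ∧ R i ∧ isEdgeᵇ a) (adj-sym G i j))

  inside-handshake : sum (λ i → sum (λ j → ⟦ inside i j ⟧)) ≡ countPairs inside + countPairs inside
  inside-handshake = begin
    sum (λ i → sum (λ j → ⟦ inside i j ⟧))
      ≡⟨ handshake (λ i j → ⟦ inside i j ⟧) (λ i j → cong ⟦_⟧ (inside-sym i j)) no-loop ⟩
    pairSum (λ i j → ⟦ inside i j ⟧) + pairSum (λ i j → ⟦ inside i j ⟧)
      ≡⟨ cong₂ _+_ (countPairs≡pairSum inside) (countPairs≡pairSum inside) ⟨
    countPairs inside + countPairs inside ∎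
    where
    open ≡-Reasoning
    no-loop : ∀ i → ⟦ inside i i ⟧ ≡ 0
    no-loop i rewrite adj-irrefl G i | ∧-zeroʳ (R i) | ∧-zeroʳ (R i) = refl

  glue : (τ σ : Fin N → Bool) → Fin N → Bool
  glue τ σ i = if R i then τ i else σ i

  touchingSatisfied : (τ σ : Fin N → Bool) → Fin N → Fin N → Bool
  touchingSatisfied τ σ i j = (R i ∨ R j) ∧ satisfiedᵇ (adj G i j) (glue τ σ i) (glue τ σ j)

  SatisfiesInside : (Fin N → Bool) → Set
  SatisfiesInside τ = ∀ i j → R i ≡ true → R j ≡ true → Adjacent G i j →
    satisfiedᵇ (adj G i j) (τ i) (τ j) ≡ true

  switching : ∀ τ σ → SatisfiesInside τ →
    countPairs (touchingSatisfied τ σ) + countPairs (touchingSatisfied (λ i → not (τ i)) σ)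
      ≡ countPairs touching + countPairs inside
  switching τ σ τ-inside = begin
    countPairs (touchingSatisfied τ σ) + countPairs (touchingSatisfied (λ i → not (τ i)) σ)
      ≡⟨ countPairs-+ (touchingSatisfied τ σ) (touchingSatisfied (λ i → not (τ i)) σ) ⟩
    pairSum (λ i j → ⟦ touchingSatisfied τ σ i j ⟧ + ⟦ touchingSatisfied (λ i → not (τ i)) σ i j ⟧)
      ≡⟨ pairSum-cong (λ i j → per-pair (R i) (R j) (adj G i j) (τ i) (τ j) (σ i) (σ j) (τ-inside i j)) ⟩
    pairSum (λ i j → ⟦ touching i j ⟧ + ⟦ inside i j ⟧)
      ≡⟨ countPairs-+ touching inside ⟨
    countPairs touching + countPairs inside ∎
    where
    open ≡-Reasoning
    per-pair : ∀ ri rj a ti tj si sj → (ri ≡ true → rj ≡ true → a ≢ nothing → satisfiedᵇ a ti tj ≡ true) →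
      ⟦ (ri ∨ rj) ∧ satisfiedᵇ a (if ri then ti else si) (if rj then tj else sj) ⟧
        + ⟦ (ri ∨ rj) ∧ satisfiedᵇ a (if ri then not ti else si) (if rj then not tj else sj) ⟧
        ≡ ⟦ (ri ∨ rj) ∧ isEdgeᵇ a ⟧ + ⟦ ri ∧ rj ∧ isEdgeᵇ a ⟧
    per-pair true  true  nothing  ti tj si sj sat = refl
    per-pair true  true  (just s) ti tj si sj sat
      rewrite satisfied-not (just s) ti tj | sat refl refl (λ ()) = refl
    per-pair true  false a ti tj si sj sat = trans (satisfied-flipˡ a ti sj) (sym (+-identityʳ _))
    per-pair false true  a ti tj si sj sat = trans (satisfied-flipʳ a si tj) (sym (+-identityʳ _))
    per-pair false false a ti tj si sj sat = refl

  glue-kept : ∀ τ σ {i} → R i ≡ false → glue τ σ i ≡ σ i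
  glue-kept τ σ Ri rewrite Ri = refl

  extend : ∀ (H′ : Subgraph G-R) σ → σ Balances H′ → ∀ τ →
    Σ (Subgraph G) λ H → Balanced H × ∣E[ H ]∣ ≡ ∣E[ H′ ]∣ + countPairs (touchingSatisfied τ σ)
  extend H′ σ σ-bal τ = H , (glue τ σ , glue-balances) , countPairs-split new-disjoint
    where
    Q : Fin N → Fin N → Bool
    Q = touchingSatisfied τ σ

    old-ends : ∀ {i j} → F H′ i j ≡ true → R i ≡ false × R j ≡ false
    old-ends {i} {j} f with F-ends H′ i j f
    ... | Wi , Wj = kept⇒¬removed (W⊆V H′ i Wi) , kept⇒¬removed (W⊆V H′ j Wj)

    new-disjoint : ∀ i j → ⟦ F H′ i j ∨ Q i j ⟧ ≡ ⟦ F H′ i j ⟧ + ⟦ Q i j ⟧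
    new-disjoint i j = ⟦⟧-∨-disjoint (F H′ i j) (Q i j) old⇒¬new
      where
      old⇒¬new : F H′ i j ≡ true → Q i j ≡ false
      old⇒¬new f with old-ends f
      ... | Ri , Rj rewrite Ri | Rj = refl

    edge : ∀ i j → F H′ i j ∨ Q i j ≡ true → Adjacent G i j
    edge i j h with ∨≡true⁻ (F H′ i j) h
    ... | inj₁ f = adjacent-kept (F⊆E H′ i j f)
    ... | inj₂ q = satisfied⇒edge (adj G i j) (∧≡true⁻ʳ (R i ∨ R j) q)

    H : Subgraph G
    H = record
      { W      = V G
      ; F      = λ i j → F H′ i j ∨ Q i j
      ; W⊆V    = λ _ Vi → Vi
      ; F-sym  = λ i j → cong₂ _∨_ (F-sym H′ i j) (cong₂ _∧_ (∨-comm (R i) (R j))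
                   (trans (satisfied-sym (adj G i j) _ _) (cong (λ a → satisfiedᵇ a _ _) (adj-sym G i j))))
      ; F⊆E    = edge
      ; F-ends = λ i j h → adj-in G i j (edge i j h)
      }

    glue-balances : glue τ σ Balances H
    glue-balances i j h with ∨≡true⁻ (F H′ i j) h
    ... | inj₂ q = satisfied-sound (adj G i j) _ _ (∧≡true⁻ʳ (R i ∨ R j) q)
    ... | inj₁ f with old-ends f | σ-bal i j f
    ... | Ri , Rj | pos-ok , neg-ok =
      (λ p → trans (glue-kept τ σ Ri) (trans (pos-ok (trans (adj-kept Ri Rj) p)) (sym (glue-kept τ σ Rj)))) ,
      (λ n eq → neg-ok (trans (adj-kept Ri Rj) n) (trans (sym (glue-kept τ σ Ri)) (trans eq (glue-kept τ σ Rj))))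

  ExtendsWithin : Subgraph G-R → Set
  ExtendsWithin H′ = Σ (Subgraph G) λ H → Balanced H ×
    2 * ∣E[ H′ ]∣ + (countPairs touching + countPairs inside) ≤ 2 * ∣E[ H ]∣

  extension : ∀ (H′ : Subgraph G-R) → Balanced H′ → ∀ τ → SatisfiesInside τ → ExtendsWithin H′
  extension H′ (σ , σ-bal) τ τ-inside = [ use-τ , use-τ′ ]′ (≤-total (S τ′) (S τ))
    where
    τ′ : Fin N → Bool
    τ′ i = not (τ i)

    S : (Fin N → Bool) → ℕ
    S ρ = countPairs (touchingSatisfied ρ σ)

    grow : ∀ ρ → countPairs touching + countPairs inside ≤ 2 * S ρ → ExtendsWithin H′
    grow ρ bound with extend H′ σ σ-bal ρ
    ... | H , balanced , size = H , balanced , (begin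
      2 * ∣E[ H′ ]∣ + (countPairs touching + countPairs inside) ≤⟨ +-monoʳ-≤ (2 * ∣E[ H′ ]∣) bound ⟩
      2 * ∣E[ H′ ]∣ + 2 * S ρ                                   ≡⟨ *-distribˡ-+ 2 ∣E[ H′ ]∣ (S ρ) ⟨
      2 * (∣E[ H′ ]∣ + S ρ)                                     ≡⟨ cong (2 *_) size ⟨
      2 * ∣E[ H ]∣                                              ∎)
      where open ≤-Reasoning

    use-τ : S τ′ ≤ S τ → ExtendsWithin H′
    use-τ S′≤S = grow τ (subst (_≤ 2 * S τ) (switching τ σ τ-inside) (+-≤-double S′≤S))

    use-τ′ : S τ ≤ S τ′ → ExtendsWithin H′
    use-τ′ S≤S′ = grow τ′
      (subst (_≤ 2 * S τ′) (trans (+-comm (S τ′) (S τ)) (switching τ σ τ-inside)) (+-≤-double S≤S′))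

module Star {N} (G : SignedGraph N) (v : Fin N) {c} (us : Fin c → Fin N) where

  R : Fin N → Bool
  R = removedSet v us

  leaf : Fin N → Bool
  leaf i = any (λ t → ⌊ i ≟ us t ⌋) (allFin c)

  leaves : ℕ
  leaves = sum (λ i → ⟦ leaf i ⟧)

  open Deletion G R

  leaf-witness : ∀ {i} → leaf i ≡ true → ∃ λ t → i ≡ us t
  leaf-witness {i} l with tabulate⁻ (any⁻ (λ t → ⌊ i ≟ us t ⌋) (allFin c) (Equivalence.from T-≡ l))
  ... | t , i≟ut = t , toWitness i≟ut

  removed-cases : ∀ {i} → R i ≡ true → i ≡ v ⊎ ∃ λ t → i ≡ us t
  removed-cases {i} Ri with ∨≡true⁻ ⌊ i ≟ v ⌋ Ri
  ... | inj₁ i≟v = inj₁ (≟-sound i≟v)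
  ... | inj₂ l   = inj₂ (leaf-witness l)

  removed-count : sum (λ i → ⟦ R i ⟧) ≤ suc leaves
  removed-count = begin
    sum (λ i → ⟦ R i ⟧)                                  ≤⟨ ∑-mono-≤ (λ i → ⟦∨⟧-≤ ⌊ i ≟ v ⌋ (leaf i)) ⟩
    sum (λ i → ⟦ ⌊ i ≟ v ⌋ ⟧ + ⟦ leaf i ⟧)               ≡⟨ ∑-distrib-+ (λ i → ⟦ ⌊ i ≟ v ⌋ ⟧) (λ i → ⟦ leaf i ⟧) ⟩
    sum (λ i → ⟦ ⌊ i ≟ v ⌋ ⟧) + leaves                   ≡⟨ cong (_+ leaves) (∑-δ v) ⟩
    suc leaves                                           ∎
    where open ≤-Reasoning

  c≤leaves : Injective _≡_ _≡_ us → c ≤ leaves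
  c≤leaves us-inj = begin
    c                                                ≡⟨ ∑-const-1 c ⟨
    sum {c} (λ _ → 1)                                ≡⟨ sum-cong-≗ (λ t → ∑-δ (us t)) ⟨
    sum (λ t → sum (λ i → ⟦ ⌊ i ≟ us t ⌋ ⟧))         ≡⟨ ∑-comm (λ t i → ⟦ ⌊ i ≟ us t ⌋ ⟧) ⟩
    sum (λ i → sum (λ t → ⟦ ⌊ i ≟ us t ⌋ ⟧))         ≤⟨ ∑-mono-≤ (λ i → ∑⟦⟧≤⟦any⟧ (λ t → ⌊ i ≟ us t ⌋) (λ t → t) (unique i)) ⟩
    leaves                                           ∎
    where
    open ≤-Reasoning
    unique : ∀ i s t → ⌊ i ≟ us s ⌋ ≡ true → ⌊ i ≟ us t ⌋ ≡ true → s ≡ t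
    unique i s t i≟us i≟ut =
      us-inj (trans (sym (≟-sound i≟us)) (≟-sound i≟ut))

  hub-removed : R v ≡ true
  hub-removed = cong (_∨ leaf v) (Equivalence.to T-≡ (fromWitness refl))

  leaf-removed : ∀ {i} → leaf i ≡ true → R i ≡ true
  leaf-removed {i} l = trans (cong (⌊ i ≟ v ⌋ ∨_) l) (∨-zeroʳ ⌊ i ≟ v ⌋)

  starSigning : Fin N → Bool
  starSigning i = negativeᵇ (adj G v i)

  starSigning-inside : (∀ s t → ¬ Adjacent G (us s) (us t)) → SatisfiesInside starSigning
  starSigning-inside leaves-indep i j Ri Rj ij with removed-cases Ri | removed-cases Rj
  ... | inj₁ refl        | inj₁ refl        = ⊥-elim (ij (adj-irrefl G v))
  ... | inj₁ refl        | inj₂ _           = satisfied-negativeᵇ (adj G v j) (adj-irrefl G v) ij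
  ... | inj₂ _           | inj₁ refl        =
    subst (λ a → satisfiedᵇ a (starSigning i) (starSigning v) ≡ true) (adj-sym G v i)
      (trans (satisfied-sym (adj G v i) _ _)
             (satisfied-negativeᵇ (adj G v i) (adj-irrefl G v) (λ vi → ij (trans (adj-sym G i v) vi))))
  ... | inj₂ (s , refl)  | inj₂ (t , refl)  = ⊥-elim (leaves-indep s t ij)

  module _ (hub-adj : ∀ t → Adjacent G v (us t)) where

    hub-not-leaf : leaf v ≡ false
    hub-not-leaf = ¬-not λ l → let (t , v≡ut) = leaf-witness l in
      hub-adj t (trans (cong (adj G v) (sym v≡ut)) (adj-irrefl G v))

    leaf⇒inside : ∀ {j} → leaf j ≡ true → inside v j ≡ true
    leaf⇒inside l with leaf-witness l
    ... | t , refl = cong₂ _∧_ hub-removed (cong₂ _∧_ (leaf-removed l) (isEdgeᵇ-adjacent (hub-adj t)))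

    -- Over ordered pairs each spoke v uₜ is counted twice, as is each inside edge in
    -- inside-handshake.
    spoke : Fin N → Fin N → ℕ
    spoke i j = ⟦ ⌊ i ≟ v ⌋ ⟧ * ⟦ leaf j ⟧ + ⟦ ⌊ j ≟ v ⌋ ⟧ * ⟦ leaf i ⟧

    spoke≤inside : ∀ i j → spoke i j ≤ ⟦ inside i j ⟧
    spoke≤inside i j = by-cases (i ≟ v) (j ≟ v)
      where
      by-cases : (i≟v : Dec (i ≡ v)) (j≟v : Dec (j ≡ v)) →
        ⟦ ⌊ i≟v ⌋ ⟧ * ⟦ leaf j ⟧ + ⟦ ⌊ j≟v ⌋ ⟧ * ⟦ leaf i ⟧ ≤ ⟦ inside i j ⟧
      by-cases (yes refl) (yes refl) rewrite hub-not-leaf = z≤n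
      by-cases (yes refl) (no _) =
        ≤-trans (≤-reflexive (trans (+-identityʳ _) (*-identityˡ _))) (⟦⟧-mono leaf⇒inside)
      by-cases (no _) (yes refl) =
        ≤-trans (≤-reflexive (*-identityˡ _)) (⟦⟧-mono (λ l → trans (inside-sym i v) (leaf⇒inside l)))
      by-cases (no _) (no _) = z≤n

    leaves≤inside : leaves + leaves ≤ countPairs inside + countPairs inside
    leaves≤inside = begin
      leaves + leaves
        ≡⟨ cong₂ _+_ (∑∑-δ v (λ j → ⟦ leaf j ⟧))
                     (trans (∑-comm (λ i j → ⟦ ⌊ j ≟ v ⌋ ⟧ * ⟦ leaf i ⟧)) (∑∑-δ v (λ i → ⟦ leaf i ⟧))) ⟨
      sum (λ i → sum (λ j → ⟦ ⌊ i ≟ v ⌋ ⟧ * ⟦ leaf j ⟧)) + sum (λ i → sum (λ j → ⟦ ⌊ j ≟ v ⌋ ⟧ * ⟦ leaf i ⟧))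
        ≡⟨ ∑∑-distrib-+ (λ i j → ⟦ ⌊ i ≟ v ⌋ ⟧ * ⟦ leaf j ⟧) (λ i j → ⟦ ⌊ j ≟ v ⌋ ⟧ * ⟦ leaf i ⟧) ⟨
      sum (λ i → sum (λ j → spoke i j))
        ≤⟨ ∑-mono-≤ (λ i → ∑-mono-≤ (λ j → spoke≤inside i j)) ⟩
      sum (λ i → sum (λ j → ⟦ inside i j ⟧))
        ≡⟨ inside-handshake ⟩
      countPairs inside + countPairs inside ∎
      where open ≤-Reasoning

budget : ∀ {m m′ T n n′ r L c I e e′ : ℕ} →
  m ≡ m′ + T → n ≤ n′ + r → r ≤ suc L → c ≤ L → L + L ≤ I + I → 2 * e′ + (T + I) ≤ 2 * e →
  4 * e′ + (2 * m + n + c) ≤ 4 * e + (2 * m′ + n′ + 1)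
budget {m} {m′} {T} {n} {n′} {r} {L} {c} {I} {e} {e′} refl n≤ r≤ c≤L L+L≤ grow = begin
  4 * e′ + (2 * (m′ + T) + n + c)
    ≤⟨ +-monoʳ-≤ (4 * e′) (+-monoˡ-≤ c (+-monoʳ-≤ (2 * (m′ + T)) (≤-trans n≤ (+-monoʳ-≤ n′ r≤)))) ⟩
  4 * e′ + (2 * (m′ + T) + (n′ + suc L) + c)
    ≡⟨ solve (e′ ∷ m′ ∷ T ∷ n′ ∷ L ∷ c ∷ []) ⟩
  2 * (2 * e′ + T) + (L + c) + (2 * m′ + n′ + 1)
    ≤⟨ +-monoˡ-≤ (2 * m′ + n′ + 1) (+-monoʳ-≤ (2 * (2 * e′ + T)) (≤-trans (+-monoʳ-≤ L c≤L) L+L≤)) ⟩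
  2 * (2 * e′ + T) + (I + I) + (2 * m′ + n′ + 1)
    ≡⟨ solve (e′ ∷ T ∷ I ∷ m′ ∷ n′ ∷ []) ⟩
  2 * (2 * e′ + (T + I)) + (2 * m′ + n′ + 1)
    ≤⟨ +-monoˡ-≤ (2 * m′ + n′ + 1) (*-monoʳ-≤ 2 grow) ⟩
  2 * (2 * e) + (2 * m′ + n′ + 1)
    ≡⟨ solve (e ∷ m′ ∷ n′ ∷ []) ⟩
  4 * e + (2 * m′ + n′ + 1) ∎
  where open ≤-Reasoning

-- slack is the difference of the bound for (G, k) and the one for (G − R, k − c + 1), with
-- every term moved to the side where it is nonnegative.
transfer : ∀ (k : ℤ) (m n e m′ n′ e′ c : ℕ) →
  4 * e′ + (2 * m + n + c) ≤ 4 * e + (2 * m′ + n′ + 1) →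
  + (2 * m′) +ℤ (+ n′ - + 1) +ℤ (k - + c +ℤ + 1) ≤ℤ + (4 * e′) →
  + (2 * m) +ℤ (+ n - + 1) +ℤ k ≤ℤ + (4 * e)
transfer k m n e m′ n′ e′ c slack old = begin
  + (2 * m) +ℤ (+ n - + 1) +ℤ k
    ≡⟨ regroup (+ (2 * m)) (+ n) k (+ (2 * m′)) (+ n′) (+ c) ⟩
  + (2 * m′) +ℤ (+ n′ - + 1) +ℤ (k - + c +ℤ + 1) +ℤ (A - B)
    ≤⟨ +ℤ-monoˡ-≤ (A - B) old ⟩
  + (4 * e′) +ℤ (A - B)
    ≡⟨ reassoc (+ (4 * e′)) A B ⟩
  + (4 * e′) +ℤ A - B
    ≡⟨ cong (_- B) (pos-+₃ (4 * e′) (2 * m) n c) ⟨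
  + (4 * e′ + (2 * m + n + c)) - B
    ≤⟨ +ℤ-monoˡ-≤ (- B) (+≤+ slack) ⟩
  + (4 * e + (2 * m′ + n′ + 1)) - B
    ≡⟨ cong (_- B) (pos-+₃ (4 * e) (2 * m′) n′ 1) ⟩
  + (4 * e) +ℤ B - B
    ≡⟨ cancel (+ (4 * e)) B ⟩
  + (4 * e) ∎
  where
  open ℤ-≤-Reasoning
  A B : ℤ
  A = + (2 * m) +ℤ + n +ℤ + c
  B = + (2 * m′) +ℤ + n′ +ℤ + 1

  regroup : ∀ (M N K M′ N′ C : ℤ) →
    M +ℤ (N - + 1) +ℤ K ≡ M′ +ℤ (N′ - + 1) +ℤ (K - C +ℤ + 1) +ℤ ((M +ℤ N +ℤ C) - (M′ +ℤ N′ +ℤ + 1))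
  regroup = solve-∀

  reassoc : ∀ (X Y Z : ℤ) → X +ℤ (Y - Z) ≡ X +ℤ Y - Z
  reassoc = solve-∀

  cancel : ∀ (X Y : ℤ) → X +ℤ Y - Y ≡ X
  cancel = solve-∀

  pos-+₃ : ∀ x y z w → + (x + (y + z + w)) ≡ + x +ℤ (+ y +ℤ + z +ℤ + w)
  pos-+₃ x y z w = trans (pos-+ x (y + z + w))
    (cong (λ s → + x +ℤ s) (trans (pos-+ (y + z) w) (cong (_+ℤ + w) (pos-+ y z))))

lemma4p5 : ∀ {N : ℕ} (G : SignedGraph N) (k : ℤ) (v : Fin N) (c : ℕ)
    (us : Fin c → Fin N) →
    Connected G →
    V G v ≡ true →
    2 ≤ c →
    Injective _≡_ _≡_ us →
    (∀ t → Adjacent G v (us t)) →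
    (∀ s t → ¬ Adjacent G (us s) (us t)) →
    Connected (delete G (removedSet v us)) →
    HasBigBalanced (delete G (removedSet v us)) (k - + c +ℤ + 1) →
    HasBigBalanced G k
-- Connectivity of G and G − R, v ∈ V(G) and c ≥ 2 are side conditions of the reduction rule;
-- this direction of its safeness does not need them.
lemma4p5 G k v c us _ _ _ us-inj hub-adj leaves-indep _ (H′ , H′-balanced , H′-big) =
  finish (extension H′ H′-balanced starSigning (starSigning-inside leaves-indep))
  where
  open Star G v us
  open Deletion G R

  finish : ExtendsWithin H′ → HasBigBalanced G k
  finish (H , H-balanced , growth) = H , H-balanced ,
    transfer k (∣E∣ G) (∣V∣ G) ∣E[ H ]∣ (∣E∣ G-R) (∣V∣ G-R) ∣E[ H′ ]∣ c
      (budget {m′ = ∣E∣ G-R} {T = countPairs touching} {I = countPairs inside} {e = ∣E[ H ]∣} {e′ = ∣E[ H′ ]∣}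
        ∣E∣-delete ∣V∣-delete removed-count (c≤leaves us-inj) (leaves≤inside hub-adj) growth)
      H′-big
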